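{- Let $P$ be a poset. The free Boolean algebra $FB(P)$ generated by $P$ is isomorphic to the tail algebra $Tailalg(\mathbf F_{<\omega}(P))$, where $\mathbf F_{<\omega}(P)$ is ordered by inclusion.
   Context: The free Boolean algebra generated by a poset $P$ is a Boolean algebra containing $P$ (with its order) such that every order-preserving map from $P$ into a Boolean algebra $B$ extends to a Boolean homomorphism into $B$; it is unique up to isomorphism fixing $P$. $\mathbf F_{<\omega}(P)$ is the set of finitely generated final segments of $P$, i.e. sets $\uparrow X=\{y\in P: x\le y\text{ for some } x\in X\}$ with $X$ finite. For a poset $Q$, $Tailalg(Q)$ is the Boolean subalgebra of $\mathfrak P(Q)$ generated by the principal final segments $\uparrow q=\{r\in Q: q\le r\}$, $q\in Q$. -}

module Defs where

open import Level using (Level; _⊔_; suc; Setω; Lift)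
open import Data.Unit using (⊤)
open import Data.Empty using (⊥)
open import Data.Product using (Σ; ∃; ∃-syntax; _×_; _,_; proj₁; proj₂)
open import Data.List using (List)
open import Data.List.Membership.Propositional renaming (_∈_ to _∈L_)
open import Relation.Unary using (Pred; _⊆_; _≐_; _∩_; _∪_; ∁; U; ∅; _∈_)
open import Relation.Binary.Bundles using (Poset)
open import Relation.Binary.Structures using (IsPartialOrder; IsPreorder; IsEquivalence)
open import Algebra.Lattice.Bundles using (BooleanAlgebra)

private
  variable
    a b c ℓ ℓ₁ ℓ₂ ℓ₃ : Level

data BTerm (X : Set a) : Set a where
  var      : X → BTerm X
  top bot  : BTerm X
  _and_    : BTerm X → BTerm X → BTerm X
  _or_     : BTerm X → BTerm X → BTerm X
  not      : BTerm X → BTerm X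

evalBA : {X : Set a} (B : BooleanAlgebra b ℓ) → (X → BooleanAlgebra.Carrier B) →
         BTerm X → BooleanAlgebra.Carrier B
evalBA B g (var x)   = g x
evalBA B g top       = BooleanAlgebra.⊤ B
evalBA B g bot       = BooleanAlgebra.⊥ B
evalBA B g (s and t) = BooleanAlgebra._∧_ B (evalBA B g s) (evalBA B g t)
evalBA B g (s or t)  = BooleanAlgebra._∨_ B (evalBA B g s) (evalBA B g t)
evalBA B g (not t)   = BooleanAlgebra.¬_ B (evalBA B g t)

LeqBA : (B : BooleanAlgebra b ℓ) → BooleanAlgebra.Carrier B → BooleanAlgebra.Carrier B → Set ℓ
LeqBA B x y = x ∧ y ≈ x
  where open BooleanAlgebra B

record BoolHom (B : BooleanAlgebra b ℓ₁) (C : BooleanAlgebra c ℓ₂) : Set (b ⊔ c ⊔ ℓ₁ ⊔ ℓ₂) where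
  module B = BooleanAlgebra B
  module C = BooleanAlgebra C
  field
    ⟦_⟧    : B.Carrier → C.Carrier
    cong   : ∀ {x y} → x B.≈ y → ⟦ x ⟧ C.≈ ⟦ y ⟧
    hom-∧  : ∀ x y → ⟦ x B.∧ y ⟧ C.≈ (⟦ x ⟧ C.∧ ⟦ y ⟧)
    hom-∨  : ∀ x y → ⟦ x B.∨ y ⟧ C.≈ (⟦ x ⟧ C.∨ ⟦ y ⟧)
    hom-¬  : ∀ x → ⟦ B.¬ x ⟧ C.≈ C.¬ ⟦ x ⟧
    hom-⊤  : ⟦ B.⊤ ⟧ C.≈ C.⊤
    hom-⊥  : ⟦ B.⊥ ⟧ C.≈ C.⊥

record IsFreeBA (P : Poset a ℓ₁ ℓ₂) (B : BooleanAlgebra b ℓ)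
                (e : Poset.Carrier P → BooleanAlgebra.Carrier B) : Setω where
  module P = Poset P
  module B = BooleanAlgebra B
  field
    order-embedding : ∀ x y → (x P.≤ y → LeqBA B (e x) (e y)) × (LeqBA B (e x) (e y) → x P.≤ y)
    generated       : ∀ (x : B.Carrier) → ∃[ t ] (x B.≈ evalBA B e t)
    extends         : ∀ {c ℓ'} (C : BooleanAlgebra c ℓ') (f : P.Carrier → BooleanAlgebra.Carrier C) →
                      (∀ {x y} → x P.≤ y → LeqBA C (f x) (f y)) →
                      Σ (BoolHom B C) λ h → ∀ p → BooleanAlgebra._≈_ C (BoolHom.⟦_⟧ h (e p)) (f p)

module _ (P : Poset a ℓ₁ ℓ₂) where
  open Poset P

  ↑fin : List Carrier → Pred Carrier (a ⊔ ℓ₂)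
  ↑fin X y = ∃[ x ] (x ∈L X × x ≤ y)

  FinGenFinalSeg : Set (suc (a ⊔ ℓ₂))
  FinGenFinalSeg = Σ (Pred Carrier (a ⊔ ℓ₂)) λ S → ∃[ X ] (S ≐ ↑fin X)

  Fω : Poset (suc (a ⊔ ℓ₂)) (a ⊔ ℓ₂) (a ⊔ ℓ₂)
  Fω = record
    { Carrier = FinGenFinalSeg
    ; _≈_ = λ S T → proj₁ S ≐ proj₁ T
    ; _≤_ = λ S T → proj₁ S ⊆ proj₁ T
    ; isPartialOrder = record
      { isPreorder = record
        { isEquivalence = record
          { refl  = (λ z → z) , (λ z → z)
          ; sym   = λ (p , q) → q , p
          ; trans = λ (p , q) (r , s) → (λ z → r (p z)) , (λ z → q (s z))
          }
        ; reflexive = proj₁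
        ; trans = λ p q z → q (p z)
        }
      ; antisym = _,_
      }
    }

-- Tailalg(Q): the Boolean subalgebra of 𝔓(Q) generated by the principal
-- final segments ↑q.  Subsets are predicates, compared by _≐_;
-- Boolean operations of 𝔓(Q): ∩, ∪, complement ∁, U (=Q), ∅.

module _ (Q : Poset a ℓ₁ ℓ₂) where
  open Poset Q

  ↑pt : Carrier → Pred Carrier ℓ₂
  ↑pt q r = q ≤ r

  evalSet : BTerm Carrier → Pred Carrier ℓ₂
  evalSet (var q)   = ↑pt q
  evalSet top       = λ _ → Lift ℓ₂ ⊤
  evalSet bot       = λ _ → Lift ℓ₂ ⊥
  evalSet (s and t) = evalSet s ∩ evalSet t
  evalSet (s or t)  = evalSet s ∪ evalSet t
  evalSet (not t)   = ∁ (evalSet t)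

  InTailalg : Pred Carrier ℓ₂ → Set (a ⊔ ℓ₂)
  InTailalg A = ∃[ t ] (A ≐ evalSet t)

  record IsoToTailalg (B : BooleanAlgebra b ℓ) : Set (a ⊔ b ⊔ ℓ ⊔ suc ℓ₂) where
    private module B = BooleanAlgebra B
    field
      φ      : B.Carrier → Pred Carrier ℓ₂
      φ-into : ∀ x → InTailalg (φ x)
      φ-cong : ∀ {x y} → x B.≈ y → φ x ≐ φ y
      φ-inj  : ∀ {x y} → φ x ≐ φ y → x B.≈ y
      φ-onto : ∀ A → InTailalg A → ∃[ x ] (φ x ≐ A)
      φ-∧    : ∀ x y → φ (x B.∧ y) ≐ (φ x ∩ φ y)
      φ-∨    : ∀ x y → φ (x B.∨ y) ≐ (φ x ∪ φ y)
      φ-¬    : ∀ x → φ (B.¬ x) ≐ ∁ (φ x)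
      φ-⊤    : φ B.⊤ ≐ U
      φ-⊥    : φ B.⊥ ≐ ∅

{-# OPTIONS --safe #-}
module Submission where

-- Sending p to {S ∈ F_{<ω}(P) : p ∈ S} is monotone, so it extends to a Boolean
-- homomorphism φ from FB(P) into the power set of F_{<ω}(P).  As p ∈ S iff ↑p ⊆ S,
-- φ sends each generator p to the principal final segment of ↑p, so φ lands in the
-- tail algebra; and the principal final segment of ↑X is the image of ⋀X, so φ is
-- onto it.  For injectivity it suffices that a Boolean term t that is false at every
-- S evaluates to ⊥.  Split its value along the minterms over the variables of t:
-- a minterm with p positive, q negative and p ≤ q is ⊥, and any other minterm decides
-- t the way S = ↑(positive variables) does, i.e. negatively.

open import Defs
open import Level using (Level; _⊔_; lower) renaming (suc to lsuc)
open import Axiom.ExcludedMiddle using (ExcludedMiddle)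
open import Algebra.Bundles using (CommutativeSemiring)
open import Algebra.Lattice.Bundles using (BooleanAlgebra)
open import Data.Empty using (⊥-elim)
open import Data.List using (List; []; _∷_; _++_)
open import Data.List.Membership.Propositional using (_∈_)
open import Data.List.Membership.Propositional.Properties using (∈-++⁺ˡ; ∈-++⁺ʳ)
import Data.List.Relation.Binary.Subset.Propositional as List
open import Data.List.Relation.Unary.Any using (here; there)
open import Data.Product using (∃-syntax; _×_; _,_; proj₁; proj₂)
open import Data.Sum using (_⊎_; inj₁; inj₂; swap)
open import Data.Unit.Polymorphic using (tt)
open import Function using (_∘_; id)
open import Relation.Binary.Bundles using (Poset)
open import Relation.Binary.PropositionalEquality using (_≡_; refl; cong; cong₂)
import Relation.Binary.Reasoning.Setoid as SetoidReasoning
import Relation.Nullary as Nullary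
open import Relation.Nullary using (yes; no)
open import Relation.Nullary.Decidable using (toSum)
open import Relation.Unary using (Pred; _⊆_; _≐_; _∩_; _∪_; ∁)
import Relation.Unary.Polymorphic as Polymorphic
open import Relation.Unary.Algebra using (∪-∩-isDistributiveLattice)

powerSetBooleanAlgebra : ∀ {a} ℓ → ExcludedMiddle ℓ → (A : Set a) → BooleanAlgebra (a ⊔ lsuc ℓ) (a ⊔ ℓ)
powerSetBooleanAlgebra ℓ lem A = record
  { Carrier = Pred A ℓ
  ; _≈_ = _≐_
  ; _∨_ = _∪_
  ; _∧_ = _∩_
  ; ¬_ = ∁
  ; ⊤ = Polymorphic.U
  ; ⊥ = Polymorphic.∅
  ; isBooleanAlgebra = record
    { isDistributiveLattice = ∪-∩-isDistributiveLattice A ℓ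
    ; ∨-complement = (λ _ → (λ _ → tt) , (λ _ → swap (toSum lem)))
                   , (λ _ → (λ _ → tt) , (λ _ → toSum lem))
    ; ∧-complement = (λ _ → (λ (∉X , ∈X) → ⊥-elim (∉X ∈X)) , (λ ()))
                   , (λ _ → (λ (∈X , ∉X) → ⊥-elim (∉X ∈X)) , (λ ()))
    ; ¬-cong = λ (X⊆Y , Y⊆X) → (λ ∉X ∈Y → ∉X (Y⊆X ∈Y)) , (λ ∉Y ∈X → ∉Y (X⊆Y ∈X))
    }
  }

module BooleanAlgebraLemmas {b ℓ} (B : BooleanAlgebra b ℓ) where
  open BooleanAlgebra B hiding (refl)
  open import Algebra.Lattice.Properties.BooleanAlgebra B
  open import Algebra.Properties.CommutativeSemigroup
    (CommutativeSemiring.*-commutativeSemigroup ∨-∧-commutativeSemiring) using (x∙yz≈y∙xz)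
  open SetoidReasoning setoid

  infix 4 _≤_
  _≤_ : Carrier → Carrier → Set ℓ
  _≤_ = LeqBA B

  ≤-trans : ∀ {x y z} → x ≤ y → y ≤ z → x ≤ z
  ≤-trans {x} {y} {z} x≤y y≤z = begin
    x ∧ z        ≈⟨ ∧-congʳ x≤y ⟨
    (x ∧ y) ∧ z  ≈⟨ ∧-assoc x y z ⟩
    x ∧ (y ∧ z)  ≈⟨ ∧-congˡ y≤z ⟩
    x ∧ y        ≈⟨ x≤y ⟩
    x            ∎

  ≤-antisym : ∀ {x y} → x ≤ y → y ≤ x → x ≈ y
  ≤-antisym {x} {y} x≤y y≤x = trans (sym x≤y) (trans (∧-comm x y) y≤x)

  x∧y≤x : ∀ x y → x ∧ y ≤ x
  x∧y≤x x y = begin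
    (x ∧ y) ∧ x  ≈⟨ ∧-comm (x ∧ y) x ⟩
    x ∧ (x ∧ y)  ≈⟨ ∧-assoc x x y ⟨
    (x ∧ x) ∧ y  ≈⟨ ∧-congʳ (∧-idem x) ⟩
    x ∧ y        ∎

  x∧y≤y : ∀ x y → x ∧ y ≤ y
  x∧y≤y x y = trans (∧-assoc x y y) (∧-congˡ (∧-idem y))

  ≤-∧ : ∀ {l y z} → l ≤ y → l ≤ z → l ≤ y ∧ z
  ≤-∧ {l} {y} {z} l≤y l≤z = begin
    l ∧ (y ∧ z)  ≈⟨ ∧-assoc l y z ⟨
    (l ∧ y) ∧ z  ≈⟨ ∧-congʳ l≤y ⟩
    l ∧ z        ≈⟨ l≤z ⟩
    l            ∎

  ≤-∨ˡ : ∀ {l y} z → l ≤ y → l ≤ y ∨ z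
  ≤-∨ˡ {l} {y} z l≤y = begin
    l ∧ (y ∨ z)        ≈⟨ ∧-distribˡ-∨ l y z ⟩
    (l ∧ y) ∨ (l ∧ z)  ≈⟨ ∨-congʳ l≤y ⟩
    l ∨ (l ∧ z)        ≈⟨ ∨-absorbs-∧ l z ⟩
    l                  ∎

  ≤-∨ʳ : ∀ {l z} y → l ≤ z → l ≤ y ∨ z
  ≤-∨ʳ {l} {z} y l≤z = trans (∧-congˡ (∨-comm y z)) (≤-∨ˡ y l≤z)

  disjoint-∧ˡ : ∀ {l y} z → l ∧ y ≈ ⊥ → l ∧ (y ∧ z) ≈ ⊥
  disjoint-∧ˡ {l} {y} z l∧y≈⊥ = begin
    l ∧ (y ∧ z)  ≈⟨ ∧-assoc l y z ⟨
    (l ∧ y) ∧ z  ≈⟨ ∧-congʳ l∧y≈⊥ ⟩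
    ⊥ ∧ z        ≈⟨ ∧-zeroˡ z ⟩
    ⊥            ∎

  disjoint-∧ʳ : ∀ {l z} y → l ∧ z ≈ ⊥ → l ∧ (y ∧ z) ≈ ⊥
  disjoint-∧ʳ {l} {z} y l∧z≈⊥ = trans (∧-congˡ (∧-comm y z)) (disjoint-∧ˡ y l∧z≈⊥)

  disjoint-∨ : ∀ {l y z} → l ∧ y ≈ ⊥ → l ∧ z ≈ ⊥ → l ∧ (y ∨ z) ≈ ⊥
  disjoint-∨ {l} {y} {z} l∧y≈⊥ l∧z≈⊥ = begin
    l ∧ (y ∨ z)        ≈⟨ ∧-distribˡ-∨ l y z ⟩
    (l ∧ y) ∨ (l ∧ z)  ≈⟨ ∨-cong l∧y≈⊥ l∧z≈⊥ ⟩
    ⊥ ∨ ⊥              ≈⟨ ∨-identityʳ ⊥ ⟩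
    ⊥                  ∎

  ≤⇒disjoint-¬ : ∀ {l y} → l ≤ y → l ∧ ¬ y ≈ ⊥
  ≤⇒disjoint-¬ {l} {y} l≤y = begin
    l ∧ ¬ y        ≈⟨ ∧-congʳ l≤y ⟨
    (l ∧ y) ∧ ¬ y  ≈⟨ ∧-assoc l y (¬ y) ⟩
    l ∧ (y ∧ ¬ y)  ≈⟨ ∧-congˡ (∧-complementʳ y) ⟩
    l ∧ ⊥          ≈⟨ ∧-zeroʳ l ⟩
    ⊥              ∎

  disjoint⇒≤¬ : ∀ {l y} → l ∧ y ≈ ⊥ → l ≤ ¬ y
  disjoint⇒≤¬ {l} {y} l∧y≈⊥ = sym (begin
    l                    ≈⟨ ∧-identityʳ l ⟨
    l ∧ ⊤                ≈⟨ ∧-congˡ (∨-complementʳ y) ⟨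
    l ∧ (y ∨ ¬ y)        ≈⟨ ∧-distribˡ-∨ l y (¬ y) ⟩
    (l ∧ y) ∨ (l ∧ ¬ y)  ≈⟨ ∨-congʳ l∧y≈⊥ ⟩
    ⊥ ∨ (l ∧ ¬ y)        ≈⟨ ∨-identityˡ (l ∧ ¬ y) ⟩
    l ∧ ¬ y              ∎)

  ≤¬⇒disjoint : ∀ {l y} → l ≤ ¬ y → l ∧ y ≈ ⊥
  ≤¬⇒disjoint {l} {y} l≤¬y = trans (∧-congˡ (sym (¬-involutive y))) (≤⇒disjoint-¬ l≤¬y)

  disjoint-¬⇒≤ : ∀ {l y} → l ∧ ¬ y ≈ ⊥ → l ≤ y
  disjoint-¬⇒≤ {l} {y} l∧¬y≈⊥ = trans (∧-congˡ (sym (¬-involutive y))) (disjoint⇒≤¬ l∧¬y≈⊥)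

  ≤-contradiction : ∀ {l y} → l ≤ y → l ≤ ¬ y → l ≈ ⊥
  ≤-contradiction l≤y l≤¬y = trans (sym l≤¬y) (≤⇒disjoint-¬ l≤y)

  ⊥-by-cases : ∀ a {z} → a ∧ z ≈ ⊥ → ¬ a ∧ z ≈ ⊥ → z ≈ ⊥
  ⊥-by-cases a {z} a∧z≈⊥ ¬a∧z≈⊥ = begin
    z                    ≈⟨ ∧-identityˡ z ⟨
    ⊤ ∧ z                ≈⟨ ∧-congʳ (∨-complementʳ a) ⟨
    (a ∨ ¬ a) ∧ z        ≈⟨ ∧-distribʳ-∨ z a (¬ a) ⟩
    (a ∧ z) ∨ (¬ a ∧ z)  ≈⟨ ∨-cong a∧z≈⊥ ¬a∧z≈⊥ ⟩
    ⊥ ∨ ⊥                ≈⟨ ∨-identityʳ ⊥ ⟩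
    ⊥                    ∎

  Decides : ∀ {p} → Carrier → Carrier → Set p → Set (p ⊔ ℓ)
  Decides l y A = (A × l ≤ y) ⊎ (Nullary.¬ A × l ∧ y ≈ ⊥)

  decides-false : ∀ {p l y} {A : Set p} → Decides l y A → Nullary.¬ A → l ∧ y ≈ ⊥
  decides-false (inj₁ (holds , _)) fails = ⊥-elim (fails holds)
  decides-false (inj₂ (_ , l∧y≈⊥)) _ = l∧y≈⊥

  decides-∧ : ∀ {p q l y z} {A : Set p} {A′ : Set q} →
              Decides l y A → Decides l z A′ → Decides l (y ∧ z) (A × A′)
  decides-∧ (inj₁ (a , l≤y)) (inj₁ (a′ , l≤z)) = inj₁ ((a , a′) , ≤-∧ l≤y l≤z)
  decides-∧ {y = y} (inj₁ _) (inj₂ (¬a′ , l∧z≈⊥)) = inj₂ (¬a′ ∘ proj₂ , disjoint-∧ʳ y l∧z≈⊥)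
  decides-∧ {z = z} (inj₂ (¬a , l∧y≈⊥)) _ = inj₂ (¬a ∘ proj₁ , disjoint-∧ˡ z l∧y≈⊥)

  decides-∨ : ∀ {p q l y z} {A : Set p} {A′ : Set q} →
              Decides l y A → Decides l z A′ → Decides l (y ∨ z) (A ⊎ A′)
  decides-∨ {z = z} (inj₁ (a , l≤y)) _ = inj₁ (inj₁ a , ≤-∨ˡ z l≤y)
  decides-∨ {y = y} (inj₂ _) (inj₁ (a′ , l≤z)) = inj₁ (inj₂ a′ , ≤-∨ʳ y l≤z)
  decides-∨ (inj₂ (¬a , l∧y≈⊥)) (inj₂ (¬a′ , l∧z≈⊥)) =
    inj₂ ((λ { (inj₁ a) → ¬a a ; (inj₂ a′) → ¬a′ a′ }) , disjoint-∨ l∧y≈⊥ l∧z≈⊥)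

  decides-¬ : ∀ {p l y} {A : Set p} → Decides l y A → Decides l (¬ y) (Nullary.¬ A)
  decides-¬ (inj₁ (a , l≤y)) = inj₂ ((λ ¬a → ¬a a) , ≤⇒disjoint-¬ l≤y)
  decides-¬ (inj₂ (¬a , l∧y≈⊥)) = inj₁ (¬a , disjoint⇒≤¬ l∧y≈⊥)

  conj : ∀ {c} {X : Set c} → (X → Carrier) → List X → Carrier
  conj g [] = ⊤
  conj g (x ∷ xs) = g x ∧ conj g xs

  conj-≤ : ∀ {c} {X : Set c} (g : X → Carrier) {x xs} → x ∈ xs → conj g xs ≤ g x
  conj-≤ g {xs = y ∷ ys} (here refl) = x∧y≤x (g y) (conj g ys)
  conj-≤ g {xs = y ∷ ys} (there x∈ys) = ≤-trans (x∧y≤y (g y) (conj g ys)) (conj-≤ g x∈ys)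

  module Minterms {c} {X : Set c} (e : X → Carrier) where

    minterm : List X → List X → Carrier
    minterm Pos Neg = conj e Pos ∧ conj (¬_ ∘ e) Neg

    minterm-≤-pos : ∀ {p} Pos Neg → p ∈ Pos → minterm Pos Neg ≤ e p
    minterm-≤-pos Pos Neg p∈Pos = ≤-trans (x∧y≤x _ _) (conj-≤ e p∈Pos)

    minterm-≤-neg : ∀ {q} Pos Neg → q ∈ Neg → minterm Pos Neg ≤ ¬ e q
    minterm-≤-neg Pos Neg q∈Neg = ≤-trans (x∧y≤y _ _) (conj-≤ (¬_ ∘ e) q∈Neg)

    minterm-∷-pos : ∀ v Pos Neg → minterm (v ∷ Pos) Neg ≈ e v ∧ minterm Pos Neg
    minterm-∷-pos v Pos Neg = ∧-assoc (e v) (conj e Pos) (conj (¬_ ∘ e) Neg)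

    minterm-∷-neg : ∀ v Pos Neg → minterm Pos (v ∷ Neg) ≈ ¬ e v ∧ minterm Pos Neg
    minterm-∷-neg v Pos Neg = x∙yz≈y∙xz (conj e Pos) (¬ e v) (conj (¬_ ∘ e) Neg)

    disjoint-if-disjoint-from-complete-minterms :
      ∀ {x} V Pos Neg →
      (∀ {Pos′ Neg′} → Pos List.⊆ Pos′ → Neg List.⊆ Neg′ →
                       (∀ {v} → v ∈ V → v ∈ Pos′ ⊎ v ∈ Neg′) → minterm Pos′ Neg′ ∧ x ≈ ⊥) →
      minterm Pos Neg ∧ x ≈ ⊥
    disjoint-if-disjoint-from-complete-minterms [] Pos Neg complete = complete id id (λ ())
    disjoint-if-disjoint-from-complete-minterms {x} (v ∷ V) Pos Neg complete =
      ⊥-by-cases (e v)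
        (trans (sym (∧-assoc _ _ x)) (trans (∧-congʳ (sym (minterm-∷-pos v Pos Neg))) with-v))
        (trans (sym (∧-assoc _ _ x)) (trans (∧-congʳ (sym (minterm-∷-neg v Pos Neg))) without-v))
      where
        with-v : minterm (v ∷ Pos) Neg ∧ x ≈ ⊥
        with-v = disjoint-if-disjoint-from-complete-minterms V (v ∷ Pos) Neg
          λ Pos⊆ Neg⊆ covers → complete (Pos⊆ ∘ there) Neg⊆
            λ { (here refl) → inj₁ (Pos⊆ (here refl)) ; (there v∈V) → covers v∈V }
        without-v : minterm Pos (v ∷ Neg) ∧ x ≈ ⊥
        without-v = disjoint-if-disjoint-from-complete-minterms V Pos (v ∷ Neg)
          λ Pos⊆ Neg⊆ covers → complete Pos⊆ (Neg⊆ ∘ there)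
            λ { (here refl) → inj₂ (Neg⊆ (here refl)) ; (there v∈V) → covers v∈V }

    ≈⊥-if-disjoint-from-complete-minterms :
      ∀ {x} V → (∀ Pos Neg → (∀ {v} → v ∈ V → v ∈ Pos ⊎ v ∈ Neg) → minterm Pos Neg ∧ x ≈ ⊥) → x ≈ ⊥
    ≈⊥-if-disjoint-from-complete-minterms {x} V complete = begin
      x                      ≈⟨ ∧-identityˡ x ⟨
      ⊤ ∧ x                  ≈⟨ ∧-congʳ (∧-identityʳ ⊤) ⟨
      minterm [] [] ∧ x      ≈⟨ disjoint-if-disjoint-from-complete-minterms V [] []
                                  (λ {Pos} {Neg} _ _ → complete Pos Neg) ⟩
      ⊥                      ∎

module _ {x} {X : Set x} where

  vars : BTerm X → List X
  vars (var v)   = v ∷ []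
  vars top       = []
  vars bot       = []
  vars (s and t) = vars s ++ vars t
  vars (s or t)  = vars s ++ vars t
  vars (not t)   = vars t

  rename : ∀ {y} {Y : Set y} → (X → Y) → BTerm X → BTerm Y
  rename h (var v)   = var (h v)
  rename h top       = top
  rename h bot       = bot
  rename h (s and t) = rename h s and rename h t
  rename h (s or t)  = rename h s or rename h t
  rename h (not t)   = not (rename h t)

  evalBA-rename : ∀ {y b ℓ} {Y : Set y} (B : BooleanAlgebra b ℓ) (g : Y → BooleanAlgebra.Carrier B)
                  (h : X → Y) t → evalBA B g (rename h t) ≡ evalBA B (g ∘ h) t
  evalBA-rename B g h (var v)   = refl
  evalBA-rename B g h top       = refl
  evalBA-rename B g h bot       = refl
  evalBA-rename B g h (s and t) = cong₂ (BooleanAlgebra._∧_ B) (evalBA-rename B g h s) (evalBA-rename B g h t)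
  evalBA-rename B g h (s or t)  = cong₂ (BooleanAlgebra._∨_ B) (evalBA-rename B g h s) (evalBA-rename B g h t)
  evalBA-rename B g h (not t)   = cong (BooleanAlgebra.¬_ B) (evalBA-rename B g h t)

module _ {b c ℓ₁ ℓ₂} {B : BooleanAlgebra b ℓ₁} {C : BooleanAlgebra c ℓ₂} (h : BoolHom B C) where
  open BoolHom h

  hom-evalBA : ∀ {x} {X : Set x} {g : X → B.Carrier} {g′ : X → C.Carrier} →
               (∀ v → ⟦ g v ⟧ C.≈ g′ v) → ∀ t → ⟦ evalBA B g t ⟧ C.≈ evalBA C g′ t
  hom-evalBA on-generators (var v)   = on-generators v
  hom-evalBA on-generators top       = hom-⊤
  hom-evalBA on-generators bot       = hom-⊥
  hom-evalBA on-generators (s and t) =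
    C.trans (hom-∧ _ _) (C.∧-cong (hom-evalBA on-generators s) (hom-evalBA on-generators t))
  hom-evalBA on-generators (s or t)  =
    C.trans (hom-∨ _ _) (C.∨-cong (hom-evalBA on-generators s) (hom-evalBA on-generators t))
  hom-evalBA on-generators (not t)   = C.trans (hom-¬ _) (C.¬-cong (hom-evalBA on-generators t))

module _ {a b ℓ ℓ′ x} (lem : ExcludedMiddle ℓ′) (B : BooleanAlgebra b ℓ) {X : Set x} {A : Set a}
         (e : X → BooleanAlgebra.Carrier B) (f : X → Pred A ℓ′) where
  open import Algebra.Lattice.Properties.BooleanAlgebra B using (∧-identityʳ; ∧-zeroʳ)
  open BooleanAlgebraLemmas B using (Decides; decides-∧; decides-∨; decides-¬)

  decides-evalBA : ∀ {l} (S : A) t → (∀ {v} → v ∈ vars t → Decides l (e v) (f v S)) →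
                   Decides l (evalBA B e t) (evalBA (powerSetBooleanAlgebra ℓ′ lem A) f t S)
  decides-evalBA S (var v)   decided = decided (here refl)
  decides-evalBA S top       decided = inj₁ (tt , ∧-identityʳ _)
  decides-evalBA S bot       decided = inj₂ ((λ ()) , ∧-zeroʳ _)
  decides-evalBA S (s and t) decided =
    decides-∧ (decides-evalBA S s (decided ∘ ∈-++⁺ˡ)) (decides-evalBA S t (decided ∘ ∈-++⁺ʳ (vars s)))
  decides-evalBA S (s or t)  decided =
    decides-∨ (decides-evalBA S s (decided ∘ ∈-++⁺ˡ)) (decides-evalBA S t (decided ∘ ∈-++⁺ʳ (vars s)))
  decides-evalBA S (not t)   decided = decides-¬ (decides-evalBA S t decided)

evalSet≡evalBA : ∀ {a ℓ₁ ℓ₂} (lem : ExcludedMiddle ℓ₂) (Q : Poset a ℓ₁ ℓ₂) u →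
                 evalSet Q u ≡ evalBA (powerSetBooleanAlgebra ℓ₂ lem (Poset.Carrier Q)) (↑pt Q) u
evalSet≡evalBA lem Q (var q)   = refl
evalSet≡evalBA lem Q top       = refl
evalSet≡evalBA lem Q bot       = refl
evalSet≡evalBA lem Q (s and t) = cong₂ _∩_ (evalSet≡evalBA lem Q s) (evalSet≡evalBA lem Q t)
evalSet≡evalBA lem Q (s or t)  = cong₂ _∪_ (evalSet≡evalBA lem Q s) (evalSet≡evalBA lem Q t)
evalSet≡evalBA lem Q (not t)   = cong ∁ (evalSet≡evalBA lem Q t)

module FinitelyGeneratedFinalSegments {a ℓ₁ ℓ₂} (P : Poset a ℓ₁ ℓ₂) where
  open Poset P using (Carrier; _≤_; trans) renaming (refl to ≤-refl)

  ↑seg : List Carrier → FinGenFinalSeg P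
  ↑seg X = ↑fin P X , X , id , id

  generators : FinGenFinalSeg P → List Carrier
  generators = proj₁ ∘ proj₂

  member : Carrier → Pred (FinGenFinalSeg P) (a ⊔ ℓ₂)
  member p S = proj₁ S p

  containing : List Carrier → Pred (FinGenFinalSeg P) (a ⊔ ℓ₂)
  containing X S = ↑fin P X ⊆ proj₁ S

  member-mono : ∀ {p q} → p ≤ q → member p ⊆ member q
  member-mono p≤q {S , X , S⊆↑X , ↑X⊆S} p∈S =
    let (x , x∈X , x≤p) = S⊆↑X p∈S in ↑X⊆S (x , x∈X , trans x≤p p≤q)

  principal : Carrier → FinGenFinalSeg P
  principal p = ↑seg (p ∷ [])

  member≐↑principal : ∀ p → member p ≐ ↑pt (Fω P) (principal p)
  member≐↑principal p = (λ {S} p∈S → λ { (_ , here refl , p≤y) → member-mono p≤y {S} p∈S })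
                      , (λ ↑p⊆S → ↑p⊆S (p , here refl , ≤-refl))

  containing-[] : containing [] ≐ Polymorphic.U {ℓ = a ⊔ ℓ₂}
  containing-[] = (λ _ → tt) , (λ _ ())

  containing-∷ : ∀ p X → containing (p ∷ X) ≐ member p ∩ containing X
  containing-∷ p X = (λ ↑pX⊆S → ↑pX⊆S (p , here refl , ≤-refl) , λ (x , x∈X , x≤y) → ↑pX⊆S (x , there x∈X , x≤y))
                   , λ {S} (p∈S , ↑X⊆S) → λ { (_ , here refl , p≤y) → member-mono p≤y {S} p∈S
                                            ; (x , there x∈X , x≤y) → ↑X⊆S (x , x∈X , x≤y) }

  ↑pt≐containing : ∀ T → ↑pt (Fω P) T ≐ containing (generators T)
  ↑pt≐containing (S , X , S⊆↑X , ↑X⊆S) = (λ S⊆R → S⊆R ∘ ↑X⊆S) , (λ ↑X⊆R → ↑X⊆R ∘ S⊆↑X)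

module VanishingTerms {a ℓ₁ ℓ₂ b ℓ} (lem : ExcludedMiddle (a ⊔ ℓ₂)) (P : Poset a ℓ₁ ℓ₂)
  (B : BooleanAlgebra b ℓ) (e : Poset.Carrier P → BooleanAlgebra.Carrier B)
  (e-mono : ∀ {p q} → Poset._≤_ P p q → LeqBA B (e p) (e q)) where
  open Poset P using (Carrier) renaming (_≤_ to _⊑_; refl to ⊑-refl)
  open BooleanAlgebra B using (_≈_; _∧_; ⊥; trans; ∧-congʳ)
  open import Algebra.Lattice.Properties.BooleanAlgebra B using (∧-zeroˡ)
  open BooleanAlgebraLemmas B
  open Minterms e
  open FinitelyGeneratedFinalSegments P

  ℘F : BooleanAlgebra (lsuc (a ⊔ ℓ₂)) (lsuc (a ⊔ ℓ₂))
  ℘F = powerSetBooleanAlgebra (a ⊔ ℓ₂) lem (FinGenFinalSeg P)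

  Conflict : List Carrier → List Carrier → Set (a ⊔ ℓ₂)
  Conflict Pos Neg = ∃[ p ] ∃[ q ] (p ∈ Pos × q ∈ Neg × p ⊑ q)

  minterm-conflict : ∀ {Pos Neg} → Conflict Pos Neg → minterm Pos Neg ≈ ⊥
  minterm-conflict {Pos} {Neg} (p , q , p∈Pos , q∈Neg , p⊑q) =
    ≤-contradiction (≤-trans (minterm-≤-pos Pos Neg p∈Pos) (e-mono p⊑q)) (minterm-≤-neg Pos Neg q∈Neg)

  minterm-decides-at-↑seg : ∀ {Pos Neg} → Nullary.¬ Conflict Pos Neg →
                            ∀ {v} → v ∈ Pos ⊎ v ∈ Neg → Decides (minterm Pos Neg) (e v) (member v (↑seg Pos))
  minterm-decides-at-↑seg {Pos} {Neg} _ (inj₁ v∈Pos) =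
    inj₁ ((_ , v∈Pos , ⊑-refl) , minterm-≤-pos Pos Neg v∈Pos)
  minterm-decides-at-↑seg {Pos} {Neg} no-conflict (inj₂ v∈Neg) =
    inj₂ ( (λ (p , p∈Pos , p⊑v) → no-conflict (p , _ , p∈Pos , v∈Neg , p⊑v))
         , ≤¬⇒disjoint (minterm-≤-neg Pos Neg v∈Neg))

  evalBA-≈⊥-if-false-everywhere : ∀ t → (∀ S → Nullary.¬ evalBA ℘F member t S) → evalBA B e t ≈ ⊥
  evalBA-≈⊥-if-false-everywhere t false-everywhere = ≈⊥-if-disjoint-from-complete-minterms (vars t) complete
    where
      complete : ∀ Pos Neg → (∀ {v} → v ∈ vars t → v ∈ Pos ⊎ v ∈ Neg) → minterm Pos Neg ∧ evalBA B e t ≈ ⊥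
      complete Pos Neg covers with lem {Conflict Pos Neg}
      ... | yes conflict    = trans (∧-congʳ (minterm-conflict conflict)) (∧-zeroˡ _)
      ... | no no-conflict  =
        decides-false (decides-evalBA lem B e member (↑seg Pos) t (minterm-decides-at-↑seg no-conflict ∘ covers))
                      (false-everywhere (↑seg Pos))

module FreeBooleanAlgebraToTailAlgebra {a ℓ₁ ℓ₂ b ℓ} (lem : ∀ {ℓ′} → ExcludedMiddle ℓ′)
  (P : Poset a ℓ₁ ℓ₂) (FB : BooleanAlgebra b ℓ) (e : Poset.Carrier P → BooleanAlgebra.Carrier FB)
  (free : IsFreeBA P FB e) where
  open IsFreeBA free using (order-embedding; generated; extends)
  open BooleanAlgebra FB using (_∧_; ¬_; trans)
  open BooleanAlgebraLemmas FB using (conj; disjoint-¬⇒≤; ≤-antisym)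
  open FinitelyGeneratedFinalSegments P
  open VanishingTerms lem P FB e (λ {p} {q} → proj₁ (order-embedding p q))
  module ℘F = BooleanAlgebra ℘F

  member-≤ : ∀ {p q} → Poset._≤_ P p q → LeqBA ℘F (member p) (member q)
  member-≤ p≤q = proj₁ , λ {S} p∈S → p∈S , member-mono p≤q {S} p∈S

  φ-hom : BoolHom FB ℘F
  φ-hom = proj₁ (extends ℘F member member-≤)

  open BoolHom φ-hom renaming (⟦_⟧ to φ; cong to φ-cong)

  φ-generator : ∀ p → φ (e p) ≐ member p
  φ-generator = proj₂ (extends ℘F member member-≤)

  φ-conj : ∀ X → φ (conj e X) ≐ containing X
  φ-conj []      = ℘F.trans hom-⊤ (℘F.sym containing-[])
  φ-conj (p ∷ X) =
    ℘F.trans (hom-∧ _ _) (℘F.trans (℘F.∧-cong (φ-generator p) (φ-conj X)) (℘F.sym (containing-∷ p X)))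

  φ-reflects-≤ : ∀ {x y} → φ x ⊆ φ y → LeqBA FB x y
  φ-reflects-≤ {x} {y} φx⊆φy =
    let (t , x∧¬y≈t) = generated (x ∧ ¬ y)
        false-everywhere : ∀ S → Nullary.¬ evalBA ℘F member t S
        false-everywhere S S∈t =
          let S∈φx∧¬y = proj₂ (φ-cong x∧¬y≈t) (proj₂ (hom-evalBA φ-hom φ-generator t) S∈t)
              (S∈φx , S∉φy) = proj₁ (hom-∧ x (¬ y)) S∈φx∧¬y
          in proj₁ (hom-¬ y) S∉φy (φx⊆φy S∈φx)
    in disjoint-¬⇒≤ (trans x∧¬y≈t (evalBA-≈⊥-if-false-everywhere t false-everywhere))

  open SetoidReasoning ℘F.setoid

  φ-into : ∀ x → InTailalg (Fω P) (φ x)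
  φ-into x = let (t , x≈t) = generated x in rename principal t , (begin
    φ x                                              ≈⟨ φ-cong x≈t ⟩
    φ (evalBA FB e t)                                ≈⟨ hom-evalBA φ-hom φ-generator↑ t ⟩
    evalBA ℘F (↑pt (Fω P) ∘ principal) t             ≡⟨ evalBA-rename ℘F (↑pt (Fω P)) principal t ⟨
    evalBA ℘F (↑pt (Fω P)) (rename principal t)      ≡⟨ evalSet≡evalBA lem (Fω P) (rename principal t) ⟨
    evalSet (Fω P) (rename principal t)              ∎)
    where
      φ-generator↑ : ∀ p → φ (e p) ≐ ↑pt (Fω P) (principal p)
      φ-generator↑ p = ℘F.trans (φ-generator p) (member≐↑principal p)

  φ-onto : ∀ A → InTailalg (Fω P) A → ∃[ x ] (φ x ≐ A)
  φ-onto A (u , A≐u) = evalBA FB (conj e ∘ generators) u , (begin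
    φ (evalBA FB (conj e ∘ generators) u)   ≈⟨ hom-evalBA φ-hom φ-conj-generators u ⟩
    evalBA ℘F (↑pt (Fω P)) u                ≡⟨ evalSet≡evalBA lem (Fω P) u ⟨
    evalSet (Fω P) u                        ≈⟨ ℘F.sym A≐u ⟩
    A                                       ∎)
    where
      φ-conj-generators : ∀ T → φ (conj e (generators T)) ≐ ↑pt (Fω P) T
      φ-conj-generators T = ℘F.trans (φ-conj (generators T)) (℘F.sym (↑pt≐containing T))

  tailAlgebraIso : IsoToTailalg (Fω P) FB
  tailAlgebraIso = record
    { φ      = φ
    ; φ-into = φ-into
    ; φ-cong = φ-cong
    ; φ-inj  = λ (φx⊆φy , φy⊆φx) → ≤-antisym (φ-reflects-≤ φx⊆φy) (φ-reflects-≤ φy⊆φx)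
    ; φ-onto = φ-onto
    ; φ-∧    = hom-∧
    ; φ-∨    = hom-∨
    ; φ-¬    = hom-¬
    ; φ-⊤    = (λ _ → _) , (λ _ → proj₂ hom-⊤ tt)
    ; φ-⊥    = (λ φ⊥ → ⊥-elim (lower (proj₁ hom-⊥ φ⊥))) , (λ ())
    }

proposition4 : ∀ {a ℓ₁ ℓ₂ b ℓ : Level} →
    -- classical metatheory (the paper works in ZFC)
    (∀ {ℓ' : Level} → ExcludedMiddle ℓ') →
    (P : Poset a ℓ₁ ℓ₂) →
    -- FB(P): a free Boolean algebra generated by P, P embedded via e
    (FB : BooleanAlgebra b ℓ) (e : Poset.Carrier P → BooleanAlgebra.Carrier FB) →
    IsFreeBA P FB e →
    -- FB(P) ≅ Tailalg(F_{<ω}(P)), F_{<ω}(P) ordered by inclusion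
    IsoToTailalg (Fω P) FB
proposition4 lem P FB e free = FreeBooleanAlgebraToTailAlgebra.tailAlgebraIso lem P FB e free
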